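{- Let $n\ge1$ be an integer and let $(\alpha_{n,j})_{j=1}^{2n+1}$ and $(\beta_{n,k})_{k=1}^n$ be complex numbers. Define the rational function $$f_n(p,q)=\sum_{j=1}^{2n+1}\frac{\alpha_{n,j}}{p^{2n+j}q^{4n-j+2}}$$ and $g_n(p,q)=f_n(p,q)-f_n(p+q,q)-f_n(p,p+q)$. Then $$g_n(p,q)=\sum_{k=1}^n\frac{\beta_{n,k}}{p^{2n+2k}q^{4n-2k+2}}$$ (as rational functions in $p,q$) if and only if for every $m=2n,2n+1,\ldots,10n-2$, $$\sum_{j=1}^{2n+1}\alpha_{n,j}\left(\binom{6n}{m-4n+j}-\binom{2n+j-2}{m-4n+j}-\binom{4n-j}{m-6n}\right)=\sum_{k=1}^n\beta_{n,k}\binom{6n}{m-4n+2k}.$$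
   Context: Binomial coefficients $\binom{a}{b}$ with $a\ge0$ are taken to be $0$ when $b<0$ or $b>a$. -}

module Defs where

open import Level using (Level; _⊔_) renaming (suc to lsuc)
open import Algebra.Bundles using (CommutativeRing)
open import Data.Nat as ℕ using (ℕ; zero; suc)
open import Data.Nat.Combinatorics using (_C_)
open import Data.Integer as ℤ using (ℤ; +_; -[1+_])
open import Relation.Nullary using (¬_)

-- A field: a commutative ring with a multiplicative inverse for every
-- nonzero element (the value of _⁻¹ at 0 is irrelevant).
record Field (c ℓ : Level) : Set (lsuc (c ⊔ ℓ)) where
  field
    commutativeRing : CommutativeRing c ℓ
  open CommutativeRing commutativeRing public
  field
    _⁻¹     : Carrier → Carrier
    ⁻¹-inverse : ∀ x → ¬ (x ≈ 0#) → (x * (x ⁻¹)) ≈ 1#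
    0≉1     : ¬ (0# ≈ 1#)

module FieldOps {c ℓ} (K : Field c ℓ) where
  open Field K

  ιℕ : ℕ → Carrier
  ιℕ zero    = 0#
  ιℕ (suc n) = 1# + ιℕ n

  ιℤ : ℤ → Carrier
  ιℤ (+ n)      = ιℕ n
  ιℤ -[1+ n ]   = - ιℕ (suc n)

  _^_ : Carrier → ℕ → Carrier
  x ^ zero  = 1#
  x ^ suc n = x * (x ^ n)

  _/_ : Carrier → Carrier → Carrier
  x / y = x * (y ⁻¹)

  Σ[1…_] : ℕ → (ℕ → Carrier) → Carrier
  Σ[1… zero  ] a = 0#
  Σ[1… suc N ] a = Σ[1… N ] a + a (suc N)

CharZero : ∀ {c ℓ} → Field c ℓ → Set ℓ
CharZero K = ∀ n → ¬ (ιℕ (suc n) ≈ 0#)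
  where open Field K
        open FieldOps K

-- binomial coefficient (a choose b) with a ≥ 0 and integer b,
-- equal to 0 when b < 0 or b > a.
binom : ℕ → ℤ → ℤ
binom a (+ b)    = + (a C b)
binom a -[1+ _ ] = + 0

module Fn {c ℓ} (K : Field c ℓ) where
  open Field K
  open FieldOps K

  f : ℕ → (ℕ → Carrier) → Carrier → Carrier → Carrier
  f n α p q = Σ[1… 2 ℕ.* n ℕ.+ 1 ] (λ j → α j / ((p ^ (2 ℕ.* n ℕ.+ j)) * (q ^ ((4 ℕ.* n ℕ.+ 2) ℕ.∸ j))))

  g : ℕ → (ℕ → Carrier) → Carrier → Carrier → Carrier
  g n α p q = (f n α p q - f n α (p + q) q) - f n α p (p + q)

  h : ℕ → (ℕ → Carrier) → Carrier → Carrier → Carrier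
  h n β p q = Σ[1… n ] (λ k → β k / ((p ^ (2 ℕ.* n ℕ.+ 2 ℕ.* k)) * (q ^ ((4 ℕ.* n ℕ.+ 2) ℕ.∸ (2 ℕ.* k)))))

  coeffCond : ℕ → (ℕ → Carrier) → (ℕ → Carrier) → ℕ → Set ℓ
  coeffCond n α β m =
    Σ[1… 2 ℕ.* n ℕ.+ 1 ] (λ j → α j * ιℤ (
        (binom (6 ℕ.* n) ((+ m ℤ.- + (4 ℕ.* n)) ℤ.+ + j)
          ℤ.- binom ((2 ℕ.* n ℕ.+ j) ℕ.∸ 2) ((+ m ℤ.- + (4 ℕ.* n)) ℤ.+ + j))
          ℤ.- binom ((4 ℕ.* n) ℕ.∸ j) (+ m ℤ.- + (6 ℕ.* n))))
    ≈ Σ[1… n ] (λ k → β k * ιℤ (binom (6 ℕ.* n) ((+ m ℤ.- + (4 ℕ.* n)) ℤ.+ + (2 ℕ.* k))))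

  -- g_n = Σ_k β_k/(p^{2n+2k} q^{4n-2k+2}) as rational functions over K,
  -- i.e. at every point (p,q) where all denominators are nonzero
  RatIdentity : ℕ → (ℕ → Carrier) → (ℕ → Carrier) → Set (c ⊔ ℓ)
  RatIdentity n α β =
    (p q : Carrier) → ¬ (p ≈ 0#) → ¬ (q ≈ 0#) → ¬ ((p + q) ≈ 0#) →
      g n α p q ≈ h n β p q

  CoeffConds : ℕ → (ℕ → Carrier) → (ℕ → Carrier) → Set ℓ
  CoeffConds n α β =
    (m : ℕ) → 2 ℕ.* n ℕ.≤ m → m ℕ.≤ 10 ℕ.* n ℕ.∸ 2 → coeffCond n α β m

{-# OPTIONS --safe #-}
module Submission where

-- Multiplying by D = p^(6n) q^(6n) (p+q)^(6n) clears every denominator: each summand of g_n and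
-- of the right-hand side becomes a monomial times a power of p + q, so by the binomial theorem
-- both sides become homogeneous polynomials of degree 12n - 2 whose coefficient of p^m is the
-- corresponding side of the m-th coefficient condition (for m < 2n or m > 10n - 2 the two
-- coefficients agree automatically). As D ≠ 0 wherever p, q, p + q ≠ 0, the rational identity
-- holds iff these two polynomials agree at all such points. At q = 1 they then agree at the
-- infinitely many points p = 1, 2, 3, … of a field of characteristic zero, which forces equal
-- coefficients; conversely equal coefficients give equal polynomials.

open import Defs
open import Level using (Level)
open import Data.Nat as ℕ using (ℕ; zero; suc; z≤n; s≤s; _≤_; _<_)
open import Function.Bundles using (_⇔_; mk⇔; Equivalence)
import Data.Nat.Properties as ℕ
open import Data.Nat.Combinatorics using (_C_; nCn≡1; k>n⇒nCk≡0; nCk+nC[k+1]≡[n+1]C[k+1])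
open import Data.Integer as ℤ using (_⊖_)
import Data.Integer.Properties as ℤ
open import Relation.Nullary using (yes; no)
open import Data.Empty using (⊥-elim)
open import Function.Base using (_∘_)
open import Relation.Binary.PropositionalEquality as ≡ using (_≡_; module ≡-Reasoning)

module _ where
  open import Data.Nat.Base using (_+_; _*_; _∸_)
  open import Data.Nat.Tactic.RingSolver using (solve)
  open import Data.List.Base using ([]; _∷_)

  -- C(N, m - a), vanishing for m < a.
  shiftedBinom : ℕ → ℕ → ℕ → ℕ
  shiftedBinom zero    N m       = N C m
  shiftedBinom (suc a) N zero    = 0
  shiftedBinom (suc a) N (suc m) = shiftedBinom a N m

  binom-⊖ : ∀ N a m → binom N (m ⊖ a) ≡ ℤ.+ shiftedBinom a N m
  binom-⊖ N zero    m       = ≡.refl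
  binom-⊖ N (suc a) zero    = ≡.refl
  binom-⊖ N (suc a) (suc m) = ≡.trans (≡.cong (binom N) (ℤ.[1+m]⊖[1+n]≡m⊖n m a)) (binom-⊖ N a m)

  shiftedBinom-< : ∀ a N {m} → m < a → shiftedBinom a N m ≡ 0
  shiftedBinom-< (suc a) N {zero}  _         = ≡.refl
  shiftedBinom-< (suc a) N {suc m} (s≤s m<a) = shiftedBinom-< a N m<a

  shiftedBinom-> : ∀ a N {m} → a + N < m → shiftedBinom a N m ≡ 0
  shiftedBinom-> zero    N         a+N<m       = k>n⇒nCk≡0 a+N<m
  shiftedBinom-> (suc a) N {suc m} (s≤s a+N<m) = shiftedBinom-> a N a+N<m

  shiftedBinom-top : ∀ a N → shiftedBinom a N (a + N) ≡ 1
  shiftedBinom-top zero    N = nCn≡1 N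
  shiftedBinom-top (suc a) N = shiftedBinom-top a N

  -- Up to m = a only C(N, 0) = 1 occurs, whatever N is.
  shiftedBinom-≤ : ∀ a N N′ {m} → m ≤ a → shiftedBinom a N m ≡ shiftedBinom a N′ m
  shiftedBinom-≤ zero    N N′ {zero}  _         = ≡.refl
  shiftedBinom-≤ (suc a) N N′ {zero}  _         = ≡.refl
  shiftedBinom-≤ (suc a) N N′ {suc m} (s≤s m≤a) = shiftedBinom-≤ a N N′ m≤a

  shiftedBinom-comm : ∀ a N {m} → a + N ≤ m → shiftedBinom a N m ≡ shiftedBinom N a m
  shiftedBinom-comm a N {m} a+N≤m with m ℕ.≟ a + N
  ... | yes ≡.refl = ≡.trans (shiftedBinom-top a N) (≡.sym top)
    where top = ≡.subst (λ k → shiftedBinom N a k ≡ 1) (ℕ.+-comm N a) (shiftedBinom-top N a)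
  ... | no m≢a+N   = ≡.trans (shiftedBinom-> a N a+N<m) (≡.sym (shiftedBinom-> N a (≡.subst (_< m) (ℕ.+-comm a N) a+N<m)))
    where a+N<m = ℕ.≤∧≢⇒< a+N≤m (m≢a+N ∘ ≡.sym)

  [m-x]+j≡m⊖[x∸j] : ∀ m {x j} → j ≤ x → (ℤ.+ m ℤ.- ℤ.+ x) ℤ.+ ℤ.+ j ≡ m ⊖ (x ∸ j)
  [m-x]+j≡m⊖[x∸j] m {x} {j} j≤x = begin
    (ℤ.+ m ℤ.- ℤ.+ x) ℤ.+ ℤ.+ j  ≡⟨ ℤ.+-assoc (ℤ.+ m) (ℤ.- ℤ.+ x) (ℤ.+ j) ⟩
    ℤ.+ m ℤ.+ (ℤ.- ℤ.+ x ℤ.+ ℤ.+ j) ≡⟨ ≡.cong (λ w → ℤ.+ m ℤ.+ w) (ℤ.-m+n≡n⊖m x j) ⟩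
    ℤ.+ m ℤ.+ (j ⊖ x)             ≡⟨ ≡.cong (λ w → ℤ.+ m ℤ.+ w) (ℤ.⊖-≤ j≤x) ⟩
    ℤ.+ m ℤ.- ℤ.+ (x ∸ j)         ≡⟨ ℤ.m-n≡m⊖n m (x ∸ j) ⟩
    m ⊖ (x ∸ j)                   ∎
    where open ≡-Reasoning

  binom-shift : ∀ N m {x j} → j ≤ x → binom N ((ℤ.+ m ℤ.- ℤ.+ x) ℤ.+ ℤ.+ j) ≡ ℤ.+ shiftedBinom (x ∸ j) N m
  binom-shift N m {x} {j} j≤x = ≡.trans (≡.cong (binom N) ([m-x]+j≡m⊖[x∸j] m j≤x)) (binom-⊖ N (x ∸ j) m)

  ∸+[+]≡+ : ∀ {x j} y → j ≤ x → (x ∸ j) + (y + j) ≡ x + y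
  ∸+[+]≡+ {x} {j} y j≤x = begin
    (x ∸ j) + (y + j) ≡⟨ ≡.cong ((x ∸ j) +_) (ℕ.+-comm y j) ⟩
    (x ∸ j) + (j + y) ≡⟨ ℕ.+-assoc (x ∸ j) j y ⟨
    (x ∸ j) + j + y   ≡⟨ ≡.cong (_+ y) (ℕ.m∸n+n≡m j≤x) ⟩
    x + y             ∎
    where open ≡-Reasoning

  ∸+[+∸]≡+∸ : ∀ {x j z} y → j ≤ x → z ≤ y + j → (x ∸ j) + ((y + j) ∸ z) ≡ (x + y) ∸ z
  ∸+[+∸]≡+∸ {x} {j} {z} y j≤x z≤y+j =
    ≡.trans (≡.sym (ℕ.+-∸-assoc (x ∸ j) z≤y+j)) (≡.cong (_∸ z) (∸+[+]≡+ y j≤x))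

  +∸≤ : ∀ {i j x} → i ≤ j → j ≤ x → i + (x ∸ j) ≤ x
  +∸≤ {i} {j} {x} i≤j j≤x = begin
    i + (x ∸ j) ≡⟨ ℕ.+-comm i (x ∸ j) ⟩
    (x ∸ j) + i ≤⟨ ℕ.+-monoʳ-≤ (x ∸ j) i≤j ⟩
    (x ∸ j) + j ≡⟨ ℕ.m∸n+n≡m j≤x ⟩
    x           ∎
    where open ℕ.≤-Reasoning

  -- The j-th summand of f_n has denominator p^(A j) q^(B j); cancelling it against p^N q^N
  -- leaves p^(a j) q^(b j).
  module Exponents (n : ℕ) (1≤n : 1 ≤ n) where
    N : ℕ
    N = 6 * n

    A B a b : ℕ → ℕ
    A j = 2 * n + j
    B j = (4 * n + 2) ∸ j
    a j = 4 * n ∸ j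
    b j = (2 * n + j) ∸ 2

    degree : ℕ
    degree = 12 * n ∸ 2

    private
      1≤2n : 1 ≤ 2 * n
      1≤2n = ℕ.≤-trans 1≤n (ℕ.m≤m+n n (n + 0))

      2n+2n≡4n : 2 * n + 2 * n ≡ 4 * n
      2n+2n≡4n = ≡.sym (ℕ.*-distribʳ-+ n 2 2)

      4n+6n≡10n : 4 * n + 6 * n ≡ 10 * n
      4n+6n≡10n = ≡.sym (ℕ.*-distribʳ-+ n 4 6)

      2≤4n : 2 ≤ 4 * n
      2≤4n = ≡.subst (2 ≤_) 2n+2n≡4n (ℕ.+-mono-≤ 1≤2n 1≤2n)

      2≤6n : 2 ≤ 6 * n
      2≤6n = ℕ.≤-trans 2≤4n (ℕ.*-monoˡ-≤ n (ℕ.m≤m+n 4 2))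

    10n≤suc : ∀ {m} → 10 * n ∸ 2 < m → 10 * n ≤ suc m
    10n≤suc 10n∸2<m = ℕ.≤-trans (ℕ.m≤n+m∸n (10 * n) 2) (s≤s 10n∸2<m)

    ≤degree : ∀ {m} → m ≤ 10 * n ∸ 2 → m ≤ degree
    ≤degree m≤ = ℕ.≤-trans m≤ (ℕ.∸-monoˡ-≤ 2 (ℕ.*-monoˡ-≤ n (ℕ.m≤m+n 10 2)))

    <6n : ∀ {m} → m < 2 * n → m < 6 * n
    <6n m<2n = ℕ.≤-trans m<2n (ℕ.*-monoˡ-≤ n (ℕ.m≤m+n 2 4))

    module _ {j} (1≤j : 1 ≤ j) (j≤2n+1 : j ≤ 2 * n + 1) where
      j≤4n : j ≤ 4 * n
      j≤4n = ℕ.≤-trans j≤2n+1 (≡.subst (2 * n + 1 ≤_) 2n+2n≡4n (ℕ.+-monoʳ-≤ (2 * n) 1≤2n))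

      private
        2≤2n+j : 2 ≤ 2 * n + j
        2≤2n+j = ℕ.+-mono-≤ 1≤2n 1≤j

      p-exponents : A j + a j ≡ N
      p-exponents = begin
        (2 * n + j) + a j ≡⟨ ℕ.+-comm (2 * n + j) (a j) ⟩
        a j + (2 * n + j) ≡⟨ ∸+[+]≡+ (2 * n) j≤4n ⟩
        4 * n + 2 * n     ≡⟨ ℕ.*-distribʳ-+ n 4 2 ⟨
        6 * n             ∎
        where open ≡-Reasoning

      q-exponents : B j + b j ≡ N
      q-exponents = begin
        ((4 * n + 2) ∸ j) + b j ≡⟨ ∸+[+∸]≡+∸ (2 * n) (ℕ.m≤n⇒m≤n+o 2 j≤4n) 2≤2n+j ⟩
        (4 * n + 2 + 2 * n) ∸ 2 ≡⟨ ≡.cong (_∸ 2) 4n+2+2n≡6n+2 ⟩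
        (6 * n + 2) ∸ 2         ≡⟨ ℕ.m+n∸n≡m (6 * n) 2 ⟩
        6 * n                   ∎
        where
          open ≡-Reasoning
          4n+2+2n≡6n+2 : 4 * n + 2 + 2 * n ≡ 6 * n + 2
          4n+2+2n≡6n+2 = solve (n ∷ [])

      a+b≡6n∸2 : a j + b j ≡ 6 * n ∸ 2
      a+b≡6n∸2 = ≡.trans (∸+[+∸]≡+∸ (2 * n) j≤4n 2≤2n+j) (≡.cong (_∸ 2) (≡.sym (ℕ.*-distribʳ-+ n 4 2)))

      a+b+N≡degree : a j + b j + N ≡ degree
      a+b+N≡degree = begin
        a j + b j + 6 * n   ≡⟨ ≡.cong (_+ 6 * n) a+b≡6n∸2 ⟩
        (6 * n ∸ 2) + 6 * n ≡⟨ ℕ.+-∸-comm (6 * n) 2≤6n ⟨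
        (6 * n + 6 * n) ∸ 2 ≡⟨ ≡.cong (_∸ 2) (ℕ.*-distribʳ-+ n 6 6) ⟨
        degree              ∎
        where open ≡-Reasoning

      ≤a : ∀ {m} → m < 2 * n → m ≤ a j
      ≤a {m} m<2n = ℕ.m+n≤o⇒m≤o∸n m (ℕ.≤-pred (≡.subst (suc m + j ≤_) 2n+[2n+1]≡1+4n (ℕ.+-mono-≤ m<2n j≤2n+1)))
        where
          2n+[2n+1]≡1+4n : 2 * n + (2 * n + 1) ≡ suc (4 * n)
          2n+[2n+1]≡1+4n = solve (n ∷ [])

      a+N≤ : ∀ {m} → 10 * n ≤ suc m → a j + N ≤ m
      a+N≤ 10n≤1+m = ℕ.≤-pred (ℕ.≤-trans
        (≡.subst (suc (a j) + 6 * n ≤_) 4n+6n≡10n (ℕ.+-monoˡ-≤ (6 * n) (+∸≤ 1≤j j≤4n))) 10n≤1+m)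

      a+b< : ∀ {m} → 10 * n ≤ suc m → a j + b j < m
      a+b< 10n≤1+m = ℕ.≤-trans (s≤s (≡.subst (_≤ 6 * n) (≡.sym a+b≡6n∸2) (ℕ.m∸n≤m (6 * n) 2)))
                       (ℕ.≤-pred (ℕ.≤-trans (≡.subst (2 + 6 * n ≤_) 4n+6n≡10n (ℕ.+-monoˡ-≤ (6 * n) 2≤4n)) 10n≤1+m))

    module _ {k} (1≤k : 1 ≤ k) (k≤n : k ≤ n) where
      1≤2k : 1 ≤ 2 * k
      1≤2k = ℕ.≤-trans 1≤k (ℕ.m≤m+n k (k + 0))

      2k≤2n+1 : 2 * k ≤ 2 * n + 1
      2k≤2n+1 = ℕ.m≤n⇒m≤n+o 1 (ℕ.*-monoʳ-≤ 2 k≤n)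

      <a2k : ∀ {m} → m < 2 * n → m < a (2 * k)
      <a2k {m} m<2n =
        ℕ.m+n≤o⇒m≤o∸n (suc m) (≡.subst (suc m + 2 * k ≤_) 2n+2n≡4n (ℕ.+-mono-≤ m<2n (ℕ.*-monoʳ-≤ 2 k≤n)))

      a2k+N< : ∀ {m} → 10 * n ≤ suc m → a (2 * k) + N < m
      a2k+N< 10n≤1+m = ℕ.≤-pred (ℕ.≤-trans (≡.subst (2 + a (2 * k) + 6 * n ≤_) 4n+6n≡10n
        (ℕ.+-monoˡ-≤ (6 * n) (+∸≤ (ℕ.*-monoʳ-≤ 2 1≤k) (j≤4n 1≤2k 2k≤2n+1)))) 10n≤1+m)

module FieldLemmas {c ℓ} (K : Field c ℓ) where
  open Field K
  open FieldOps K
  open import Relation.Binary.Reasoning.Setoid setoid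
  open import Algebra.Properties.Group +-group using (∙-cancelˡ; x≈z//y; ⁻¹-involutive; ε⁻¹≈ε)
  open import Algebra.Properties.AbelianGroup +-abelianGroup using (⁻¹-∙-comm)
  open import Algebra.Properties.Ring ring using (-‿distribˡ-*; -‿distribʳ-*)
  open import Algebra.Properties.CommutativeSemigroup +-commutativeSemigroup using (x∙yz≈y∙xz)
  open import Algebra.Solver.Ring.AlmostCommutativeRing
    using (_-Raw-AlmostCommutative⟶_; fromCommutativeRing)
  open import Data.Maybe using (map)
  open import Relation.Nullary.Decidable using (dec⇒maybe)

  ≡⇒≈ : ∀ {x y} → x ≡ y → x ≈ y
  ≡⇒≈ ≡.refl = refl

  ιℕ-≡ : ∀ {m n} → m ≡ n → ιℕ m ≈ ιℕ n
  ιℕ-≡ = ≡⇒≈ ∘ ≡.cong ιℕ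

  x≈0⇒y*x≈0 : ∀ y {x} → x ≈ 0# → y * x ≈ 0#
  x≈0⇒y*x≈0 y x≈0 = trans (*-congˡ x≈0) (zeroʳ y)

  ιℕ-homo-+ : ∀ m n → ιℕ (m ℕ.+ n) ≈ ιℕ m + ιℕ n
  ιℕ-homo-+ zero    n = sym (+-identityˡ (ιℕ n))
  ιℕ-homo-+ (suc m) n = trans (+-congˡ (ιℕ-homo-+ m n)) (sym (+-assoc 1# (ιℕ m) (ιℕ n)))

  ιℕ-homo-* : ∀ m n → ιℕ (m ℕ.* n) ≈ ιℕ m * ιℕ n
  ιℕ-homo-* zero    n = sym (zeroˡ (ιℕ n))
  ιℕ-homo-* (suc m) n = begin
    ιℕ (n ℕ.+ m ℕ.* n)          ≈⟨ ιℕ-homo-+ n (m ℕ.* n) ⟩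
    ιℕ n + ιℕ (m ℕ.* n)         ≈⟨ +-cong (sym (*-identityˡ (ιℕ n))) (ιℕ-homo-* m n) ⟩
    1# * ιℕ n + ιℕ m * ιℕ n     ≈⟨ distribʳ (ιℕ n) 1# (ιℕ m) ⟨
    (1# + ιℕ m) * ιℕ n          ∎

  ιℕ-injective : CharZero K → ∀ {m n} → ιℕ m ≈ ιℕ n → m ≡ n
  ιℕ-injective cz {zero}  {zero}  _ = ≡.refl
  ιℕ-injective cz {zero}  {suc n} e = ⊥-elim (cz n (sym e))
  ιℕ-injective cz {suc m} {zero}  e = ⊥-elim (cz m e)
  ιℕ-injective cz {suc m} {suc n} e = ≡.cong suc (ιℕ-injective cz (∙-cancelˡ 1# (ιℕ m) (ιℕ n) e))

  ιℤ-⊖ : ∀ m n → ιℤ (m ⊖ n) ≈ ιℕ m - ιℕ n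
  ιℤ-⊖ m n = x≈z//y (ιℤ (m ⊖ n)) (ιℕ n) (ιℕ m) (ιℤ-⊖+ m n)
    where
      ιℤ-⊖+ : ∀ m n → ιℤ (m ⊖ n) + ιℕ n ≈ ιℕ m
      ιℤ-⊖+ m       zero    = +-identityʳ (ιℕ m)
      ιℤ-⊖+ zero    (suc n) = -‿inverseˡ (ιℕ (suc n))
      ιℤ-⊖+ (suc m) (suc n) = begin
        ιℤ (suc m ⊖ suc n) + (1# + ιℕ n) ≡⟨ ≡.cong (λ u → ιℤ u + (1# + ιℕ n)) (ℤ.[1+m]⊖[1+n]≡m⊖n m n) ⟩
        ιℤ (m ⊖ n) + (1# + ιℕ n)         ≈⟨ x∙yz≈y∙xz (ιℤ (m ⊖ n)) 1# (ιℕ n) ⟩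
        1# + (ιℤ (m ⊖ n) + ιℕ n)         ≈⟨ +-congˡ (ιℤ-⊖+ m n) ⟩
        1# + ιℕ m                        ∎

  ιℤ-homo-neg : ∀ u → ιℤ (ℤ.- u) ≈ - ιℤ u
  ιℤ-homo-neg (ℤ.+ zero)    = sym ε⁻¹≈ε
  ιℤ-homo-neg (ℤ.+ suc n)   = refl
  ιℤ-homo-neg ℤ.-[1+ n ]    = sym (⁻¹-involutive (ιℕ (suc n)))

  ιℤ-homo-+ : ∀ u v → ιℤ (u ℤ.+ v) ≈ ιℤ u + ιℤ v
  ιℤ-homo-+ (ℤ.+ m)    (ℤ.+ n)    = ιℕ-homo-+ m n
  ιℤ-homo-+ (ℤ.+ m)    ℤ.-[1+ n ] = ιℤ-⊖ m (suc n)
  ιℤ-homo-+ ℤ.-[1+ m ] (ℤ.+ n)    = trans (ιℤ-⊖ n (suc m)) (+-comm (ιℕ n) _)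
  ιℤ-homo-+ ℤ.-[1+ m ] ℤ.-[1+ n ] = begin
    - ιℕ (suc (suc (m ℕ.+ n)))              ≡⟨ ≡.cong (λ k → - ιℕ (suc k)) (ℕ.+-suc m n) ⟨
    - ιℕ (suc m ℕ.+ suc n)                  ≈⟨ -‿cong (ιℕ-homo-+ (suc m) (suc n)) ⟩
    - (ιℕ (suc m) + ιℕ (suc n))             ≈⟨ ⁻¹-∙-comm (ιℕ (suc m)) (ιℕ (suc n)) ⟨
    - ιℕ (suc m) + - ιℕ (suc n)             ∎

  ιℤ-homo-* : ∀ u v → ιℤ (u ℤ.* v) ≈ ιℤ u * ιℤ v
  ιℤ-homo-* (ℤ.+ m)    v = ιℤ-+* m v
    where
      ιℤ-+* : ∀ m v → ιℤ (ℤ.+ m ℤ.* v) ≈ ιℕ m * ιℤ v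
      ιℤ-+* m (ℤ.+ n)    = trans (≡⇒≈ (≡.cong ιℤ (≡.sym (ℤ.pos-* m n)))) (ιℕ-homo-* m n)
      ιℤ-+* m ℤ.-[1+ n ] = begin
        ιℤ (ℤ.+ m ℤ.* ℤ.-[1+ n ])       ≡⟨ ≡.cong ιℤ (ℤ.neg-distribʳ-* (ℤ.+ m) (ℤ.+ suc n)) ⟨
        ιℤ (ℤ.- (ℤ.+ m ℤ.* ℤ.+ suc n))  ≈⟨ ιℤ-homo-neg (ℤ.+ m ℤ.* ℤ.+ suc n) ⟩
        - ιℤ (ℤ.+ m ℤ.* ℤ.+ suc n)      ≈⟨ -‿cong (ιℤ-+* m (ℤ.+ suc n)) ⟩
        - (ιℕ m * ιℕ (suc n))           ≈⟨ -‿distribʳ-* (ιℕ m) (ιℕ (suc n)) ⟩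
        ιℕ m * - ιℕ (suc n)             ∎
  ιℤ-homo-* ℤ.-[1+ m ] v = begin
    ιℤ (ℤ.-[1+ m ] ℤ.* v)        ≡⟨ ≡.cong ιℤ (ℤ.neg-distribˡ-* (ℤ.+ suc m) v) ⟨
    ιℤ (ℤ.- (ℤ.+ suc m ℤ.* v))   ≈⟨ ιℤ-homo-neg (ℤ.+ suc m ℤ.* v) ⟩
    - ιℤ (ℤ.+ suc m ℤ.* v)       ≈⟨ -‿cong (ιℤ-homo-* (ℤ.+ suc m) v) ⟩
    - (ιℕ (suc m) * ιℤ v)        ≈⟨ -‿distribˡ-* (ιℕ (suc m)) (ιℤ v) ⟩
    - ιℕ (suc m) * ιℤ v          ∎

  ιℤ-homo-− : ∀ u v → ιℤ (u ℤ.- v) ≈ ιℤ u - ιℤ v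
  ιℤ-homo-− u v = trans (ιℤ-homo-+ u (ℤ.- v)) (+-congˡ (ιℤ-homo-neg v))

  ιℤ-homomorphism : ℤ.+-*-rawRing -Raw-AlmostCommutative⟶ fromCommutativeRing commutativeRing
  ιℤ-homomorphism = record
    { ⟦_⟧ = ιℤ ; +-homo = ιℤ-homo-+ ; *-homo = ιℤ-homo-* ; -‿homo = ιℤ-homo-neg
    ; 0-homo = refl ; 1-homo = +-identityʳ 1# }

  open import Algebra.Solver.Ring ℤ.+-*-rawRing (fromCommutativeRing commutativeRing) ιℤ-homomorphism
    (λ u v → map (≡⇒≈ ∘ ≡.cong ιℤ) (dec⇒maybe (u ℤ.≟ v))) public
    using (solve; _:=_; _:+_; _:*_; _:-_; con)

  x⁻¹*[x*y]≈y : ∀ {x} y → x ≉ 0# → x ⁻¹ * (x * y) ≈ y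
  x⁻¹*[x*y]≈y {x} y x≉0 = begin
    x ⁻¹ * (x * y) ≈⟨ solve 3 (λ x x⁻¹ y → x⁻¹ :* (x :* y) := (x :* x⁻¹) :* y) refl x (x ⁻¹) y ⟩
    (x * x ⁻¹) * y ≈⟨ *-congʳ (⁻¹-inverse x x≉0) ⟩
    1# * y         ≈⟨ *-identityˡ y ⟩
    y              ∎

  *-cancelˡ : ∀ {x y z} → x ≉ 0# → x * y ≈ x * z → y ≈ z
  *-cancelˡ {x} {y} {z} x≉0 xy≈xz = begin
    y              ≈⟨ x⁻¹*[x*y]≈y y x≉0 ⟨
    x ⁻¹ * (x * y) ≈⟨ *-congˡ xy≈xz ⟩
    x ⁻¹ * (x * z) ≈⟨ x⁻¹*[x*y]≈y z x≉0 ⟩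
    z              ∎

  *-≉0 : ∀ {x y} → x ≉ 0# → y ≉ 0# → x * y ≉ 0#
  *-≉0 {x} x≉0 y≉0 xy≈0 = y≉0 (*-cancelˡ x≉0 (trans xy≈0 (sym (zeroʳ x))))

  1≉0 : 1# ≉ 0#
  1≉0 1≈0 = 0≉1 (sym 1≈0)

  ^-≉0 : ∀ {x} n → x ≉ 0# → x ^ n ≉ 0#
  ^-≉0 zero    x≉0 = 1≉0
  ^-≉0 (suc n) x≉0 = *-≉0 x≉0 (^-≉0 n x≉0)

  *-/-cancel : ∀ {d} z x → d ≉ 0# → (d * z) * (x / d) ≈ x * z
  *-/-cancel {d} z x d≉0 = begin
    (d * z) * (x * d ⁻¹) ≈⟨ solve 4 (λ d z x d⁻¹ → (d :* z) :* (x :* d⁻¹) := (x :* z) :* (d :* d⁻¹)) refl d z x (d ⁻¹) ⟩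
    (x * z) * (d * d ⁻¹) ≈⟨ *-congˡ (⁻¹-inverse d d≉0) ⟩
    (x * z) * 1#         ≈⟨ *-identityʳ (x * z) ⟩
    x * z                ∎

  ^-homo-+ : ∀ x m n → x ^ (m ℕ.+ n) ≈ x ^ m * x ^ n
  ^-homo-+ x zero    n = sym (*-identityˡ (x ^ n))
  ^-homo-+ x (suc m) n = trans (*-congˡ (^-homo-+ x m n)) (sym (*-assoc x (x ^ m) (x ^ n)))

  1^n≈1 : ∀ n → 1# ^ n ≈ 1#
  1^n≈1 zero    = refl
  1^n≈1 (suc n) = trans (*-identityˡ (1# ^ n)) (1^n≈1 n)

  cancel-monomial : ∀ {u v N A a B b} w γ → u ≉ 0# → v ≉ 0# → A ℕ.+ a ≡ N → B ℕ.+ b ≡ N →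
                    (u ^ N * v ^ N * w) * (γ / (u ^ A * v ^ B)) ≈ γ * (u ^ a * v ^ b * w)
  cancel-monomial {u} {v} {N} {A} {a} {B} {b} w γ u≉0 v≉0 A+a≡N B+b≡N = begin
    (u ^ N * v ^ N * w) * (γ / (u ^ A * v ^ B))
      ≈⟨ *-congʳ (*-congʳ (*-cong (split u A a A+a≡N) (split v B b B+b≡N))) ⟩
    ((u ^ A * u ^ a) * (v ^ B * v ^ b) * w) * (γ / (u ^ A * v ^ B))
      ≈⟨ *-congʳ (solve 5 (λ U u V v w → (U :* u) :* (V :* v) :* w := (U :* V) :* (u :* v :* w))
                          refl (u ^ A) (u ^ a) (v ^ B) (v ^ b) w) ⟩
    ((u ^ A * v ^ B) * (u ^ a * v ^ b * w)) * (γ / (u ^ A * v ^ B))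
      ≈⟨ *-/-cancel _ γ (*-≉0 (^-≉0 A u≉0) (^-≉0 B v≉0)) ⟩
    γ * (u ^ a * v ^ b * w)
      ∎
    where
      split : ∀ x A a {N} → A ℕ.+ a ≡ N → x ^ N ≈ x ^ A * x ^ a
      split x A a ≡.refl = ^-homo-+ x A a

  x≈z∧y≈0⇒x-y-z≈0 : ∀ {x y z} → x ≈ z → y ≈ 0# → (x - y) - z ≈ 0#
  x≈z∧y≈0⇒x-y-z≈0 {x} {y} {z} x≈z y≈0 = begin
    (x - y) - z    ≈⟨ +-congʳ (+-cong x≈z (-‿cong y≈0)) ⟩
    (z - 0#) - z   ≈⟨ solve 1 (λ z → (z :- con (ℤ.+ 0)) :- z := con (ℤ.+ 0)) refl z ⟩
    0#             ∎

  x≈y∧z≈0⇒x-y-z≈0 : ∀ {x y z} → x ≈ y → z ≈ 0# → (x - y) - z ≈ 0#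
  x≈y∧z≈0⇒x-y-z≈0 {x} {y} {z} x≈y z≈0 = begin
    (x - y) - z    ≈⟨ +-cong (+-congʳ x≈y) (-‿cong z≈0) ⟩
    (y - y) - 0#   ≈⟨ solve 1 (λ y → (y :- y) :- con (ℤ.+ 0) := con (ℤ.+ 0)) refl y ⟩
    0#             ∎

  Σ-cong : ∀ J {u v : ℕ → Carrier} → (∀ j → 1 ≤ j → j ≤ J → u j ≈ v j) → Σ[1… J ] u ≈ Σ[1… J ] v
  Σ-cong zero    _   = refl
  Σ-cong (suc J) u≈v =
    +-cong (Σ-cong J (λ j 1≤j j≤J → u≈v j 1≤j (ℕ.m≤n⇒m≤1+n j≤J))) (u≈v (suc J) (s≤s z≤n) ℕ.≤-refl)

  Σ-≈0 : ∀ J {u : ℕ → Carrier} → (∀ j → 1 ≤ j → j ≤ J → u j ≈ 0#) → Σ[1… J ] u ≈ 0#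
  Σ-≈0 zero    _   = refl
  Σ-≈0 (suc J) u≈0 = trans
    (+-cong (Σ-≈0 J (λ j 1≤j j≤J → u≈0 j 1≤j (ℕ.m≤n⇒m≤1+n j≤J))) (u≈0 (suc J) (s≤s z≤n) ℕ.≤-refl))
    (+-identityʳ 0#)

  Σ-homo-− : ∀ J (u v : ℕ → Carrier) → Σ[1… J ] (λ j → u j - v j) ≈ Σ[1… J ] u - Σ[1… J ] v
  Σ-homo-− zero    u v = sym (-‿inverseʳ 0#)
  Σ-homo-− (suc J) u v = trans (+-congʳ (Σ-homo-− J u v))
    (solve 4 (λ U V x y → (U :- V) :+ (x :- y) := (U :+ x) :- (V :+ y)) refl (Σ[1… J ] u) (Σ[1… J ] v) (u (suc J)) (v (suc J)))


module Polynomials {c ℓ} (K : Field c ℓ) where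
  open Field K
  open FieldOps K
  open FieldLemmas K
  open import Relation.Binary.Reasoning.Setoid setoid
  open import Algebra.Properties.Group +-group
    using (inverseʳ-unique; x≈y⇒x∙y⁻¹≈ε) renaming (x∙y⁻¹≈ε⇒x≈y to x-y≈0⇒x≈y)
  open import Data.Vec.Base using (Vec; []; _∷_)
  open import Data.Vec.Relation.Unary.All using (All; []; _∷_)
  open import Function.Definitions using (Injective)

  -- Horner evaluation, constant coefficient first.
  eval : ∀ {n} → Vec Carrier n → Carrier → Carrier
  eval []      x = 0#
  eval (a ∷ v) x = a + x * eval v x

  quotient : ∀ {n} → Carrier → Vec Carrier n → Vec Carrier n
  quotient r []      = []
  quotient r (a ∷ v) = eval (a ∷ v) r ∷ quotient r v

  quotient-spec : ∀ {n} r (v : Vec Carrier n) x → x * eval v x - r * eval v r ≈ (x - r) * eval (quotient r v) x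
  quotient-spec r []      x = solve 2 (λ x r → x :* con (ℤ.+ 0) :- r :* con (ℤ.+ 0) := (x :- r) :* con (ℤ.+ 0)) refl x r
  quotient-spec r (a ∷ v) x = begin
    x * (a + x * V) - r * (a + r * W)           ≈⟨ solve 5 (λ x r a V W → x :* (a :+ x :* V) :- r :* (a :+ r :* W)
                                                     := (x :- r) :* (a :+ r :* W) :+ x :* (x :* V :- r :* W)) refl x r a V W ⟩
    (x - r) * (a + r * W) + x * (x * V - r * W) ≈⟨ +-congˡ (*-congˡ (quotient-spec r v x)) ⟩
    (x - r) * (a + r * W) + x * ((x - r) * Q)   ≈⟨ solve 5 (λ x r a W Q → (x :- r) :* (a :+ r :* W) :+ x :* ((x :- r) :* Q)
                                                     := (x :- r) :* ((a :+ r :* W) :+ x :* Q)) refl x r a W Q ⟩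
    (x - r) * ((a + r * W) + x * Q)             ∎
    where
      V = eval v x
      W = eval v r
      Q = eval (quotient r v) x

  eval-All≈0 : ∀ {n} {v : Vec Carrier n} x → All (_≈ 0#) v → eval v x ≈ 0#
  eval-All≈0 x []          = refl
  eval-All≈0 x (a≈0 ∷ v≈0) = trans (+-cong a≈0 (trans (*-congˡ (eval-All≈0 x v≈0)) (zeroʳ x))) (+-identityʳ 0#)

  a+r*v[r]≈a : ∀ {n} {v : Vec Carrier n} a r → All (_≈ 0#) v → a + r * eval v r ≈ a
  a+r*v[r]≈a a r v≈0 = trans (+-congˡ (trans (*-congˡ (eval-All≈0 r v≈0)) (zeroʳ r))) (+-identityʳ a)

  quotient-All≈0 : ∀ {n} r (v : Vec Carrier n) → All (_≈ 0#) (quotient r v) → All (_≈ 0#) v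
  quotient-All≈0 r []      []              = []
  quotient-All≈0 r (a ∷ v) (v[r]≈0 ∷ q≈0) = trans (sym (a+r*v[r]≈a a r v≈0)) v[r]≈0 ∷ v≈0
    where v≈0 = quotient-All≈0 r v q≈0

  -- Divide by x - xs 0 and recurse on the remaining points.
  vanishing⇒All≈0 : ∀ (xs : ℕ → Carrier) → Injective _≡_ _≈_ xs →
                    ∀ {n} (v : Vec Carrier n) → (∀ t → eval v (xs t) ≈ 0#) → All (_≈ 0#) v
  vanishing⇒All≈0 xs inj []      _      = []
  vanishing⇒All≈0 xs inj (a ∷ v) v[x]≈0 = trans (sym (a+r*v[r]≈a a r v≈0)) (v[x]≈0 0) ∷ v≈0
    where
      r = xs 0
      x*v[x]≈-a : ∀ t → xs t * eval v (xs t) ≈ - a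
      x*v[x]≈-a t = inverseʳ-unique a _ (v[x]≈0 t)
      q[x]≈0 : ∀ t → eval (quotient r v) (xs (suc t)) ≈ 0#
      q[x]≈0 t = *-cancelˡ (λ x-r≈0 → ℕ.1+n≢0 (inj (x-y≈0⇒x≈y _ _ x-r≈0))) (begin
        (xs (suc t) - r) * eval (quotient r v) (xs (suc t))  ≈⟨ quotient-spec r v (xs (suc t)) ⟨
        xs (suc t) * eval v (xs (suc t)) - r * eval v r      ≈⟨ x≈y⇒x∙y⁻¹≈ε (trans (x*v[x]≈-a (suc t)) (sym (x*v[x]≈-a 0))) ⟩
        0#                                                   ≈⟨ zeroʳ _ ⟨
        (xs (suc t) - r) * 0#                                ∎)
      v≈0 = quotient-All≈0 r v (vanishing⇒All≈0 (xs ∘ suc) (ℕ.suc-injective ∘ inj) (quotient r v) q[x]≈0)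


module HomogeneousPolynomials {c ℓ} (K : Field c ℓ) where
  open Field K
  open FieldOps K
  open FieldLemmas K
  open Polynomials K
  open import Relation.Binary.Reasoning.Setoid setoid
  open import Algebra.Properties.Group +-group using (x≈y⇒x∙y⁻¹≈ε) renaming (x∙y⁻¹≈ε⇒x≈y to x-y≈0⇒x≈y)
  open import Data.Fin.Base using (toℕ; fromℕ<)
  open import Data.Fin.Properties using (toℕ-fromℕ<)
  open import Data.Vec.Base using (tabulate)
  open import Data.Vec.Relation.Unary.All.Properties using (tabulate⁻)
  open import Function.Definitions using (Injective)

  -- homPoly d c p q = Σ_{i ≤ d} c i · p^i q^(d-i), by Horner's scheme in p.
  homPoly : ℕ → (ℕ → Carrier) → Carrier → Carrier → Carrier
  homPoly zero    c p q = c 0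
  homPoly (suc d) c p q = c 0 * q ^ suc d + p * homPoly d (c ∘ suc) p q

  homPoly-cong : ∀ d {c c′} p q → (∀ i → i ≤ d → c i ≈ c′ i) → homPoly d c p q ≈ homPoly d c′ p q
  homPoly-cong zero    p q c≈c′ = c≈c′ 0 z≤n
  homPoly-cong (suc d) p q c≈c′ =
    +-cong (*-congʳ (c≈c′ 0 z≤n)) (*-congˡ (homPoly-cong d p q (λ i i≤d → c≈c′ (suc i) (s≤s i≤d))))

  homPoly-0 : ∀ d p q → homPoly d (λ _ → 0#) p q ≈ 0#
  homPoly-0 zero    p q = refl
  homPoly-0 (suc d) p q = trans (+-cong (zeroˡ _) (trans (*-congˡ (homPoly-0 d p q)) (zeroʳ p))) (+-identityʳ 0#)

  homPoly-+ : ∀ d c c′ p q → homPoly d (λ i → c i + c′ i) p q ≈ homPoly d c p q + homPoly d c′ p q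
  homPoly-+ zero    c c′ p q = refl
  homPoly-+ (suc d) c c′ p q = trans (+-congˡ (*-congˡ (homPoly-+ d (c ∘ suc) (c′ ∘ suc) p q)))
    (solve 6 (λ x y Q p X Y → (x :+ y) :* Q :+ p :* (X :+ Y) := (x :* Q :+ p :* X) :+ (y :* Q :+ p :* Y)) refl
      (c 0) (c′ 0) (q ^ suc d) p (homPoly d (c ∘ suc) p q) (homPoly d (c′ ∘ suc) p q))

  homPoly-− : ∀ d c c′ p q → homPoly d (λ i → c i - c′ i) p q ≈ homPoly d c p q - homPoly d c′ p q
  homPoly-− zero    c c′ p q = refl
  homPoly-− (suc d) c c′ p q = trans (+-congˡ (*-congˡ (homPoly-− d (c ∘ suc) (c′ ∘ suc) p q)))
    (solve 6 (λ x y Q p X Y → (x :- y) :* Q :+ p :* (X :- Y) := (x :* Q :+ p :* X) :- (y :* Q :+ p :* Y)) refl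
      (c 0) (c′ 0) (q ^ suc d) p (homPoly d (c ∘ suc) p q) (homPoly d (c′ ∘ suc) p q))

  homPoly-* : ∀ d γ c p q → homPoly d (λ i → γ * c i) p q ≈ γ * homPoly d c p q
  homPoly-* zero    γ c p q = refl
  homPoly-* (suc d) γ c p q = trans (+-congˡ (*-congˡ (homPoly-* d γ (c ∘ suc) p q)))
    (solve 5 (λ γ x Q p X → γ :* x :* Q :+ p :* (γ :* X) := γ :* (x :* Q :+ p :* X)) refl
      γ (c 0) (q ^ suc d) p (homPoly d (c ∘ suc) p q))

  shift : (ℕ → Carrier) → ℕ → Carrier
  shift c zero    = 0#
  shift c (suc i) = c i

  p*homPoly : ∀ d c p q → p * homPoly d c p q ≈ homPoly (suc d) (shift c) p q
  p*homPoly d c p q = sym (trans (+-congʳ (zeroˡ _)) (+-identityˡ _))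

  q*homPoly : ∀ d c p q → c (suc d) ≈ 0# → q * homPoly d c p q ≈ homPoly (suc d) c p q
  q*homPoly zero    c p q c₁≈0 = begin
    q * c 0                           ≈⟨ solve 3 (λ q x p → q :* x := x :* (q :* con (ℤ.+ 1)) :+ p :* con (ℤ.+ 0)) refl q (c 0) p ⟩
    c 0 * (q * (1# + 0#)) + p * 0#    ≈⟨ +-cong (*-congˡ (*-congˡ (sym (+-identityʳ 1#)))) (*-congˡ c₁≈0) ⟨
    c 0 * (q * 1#) + p * c 1          ∎
  q*homPoly (suc d) c p q c≈0 = trans
    (solve 5 (λ q x Q p X → q :* (x :* Q :+ p :* X) := x :* (q :* Q) :+ p :* (q :* X)) refl
      q (c 0) (q ^ suc d) p (homPoly d (c ∘ suc) p q))
    (+-congˡ (*-congˡ (q*homPoly d (c ∘ suc) p q c≈0)))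

  binomial : ∀ N p q → (p + q) ^ N ≈ homPoly N (ιℕ ∘ (N C_)) p q
  binomial zero    p q = sym (+-identityʳ 1#)
  binomial (suc N) p q = begin
    (p + q) * (p + q) ^ N                                ≈⟨ *-congˡ (binomial N p q) ⟩
    (p + q) * homPoly N κ p q                            ≈⟨ distribʳ _ p q ⟩
    p * homPoly N κ p q + q * homPoly N κ p q            ≈⟨ +-cong (p*homPoly N κ p q) (q*homPoly N κ p q κ[1+N]≈0) ⟩
    homPoly (suc N) (shift κ) p q + homPoly (suc N) κ p q ≈⟨ homPoly-+ (suc N) (shift κ) κ p q ⟨
    homPoly (suc N) (λ i → shift κ i + κ i) p q          ≈⟨ homPoly-cong (suc N) p q pascal ⟩
    homPoly (suc N) (ιℕ ∘ (suc N C_)) p q                ∎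
    where
      κ : ℕ → Carrier
      κ = ιℕ ∘ (N C_)
      κ[1+N]≈0 : κ (suc N) ≈ 0#
      κ[1+N]≈0 = ιℕ-≡ (k>n⇒nCk≡0 (ℕ.n<1+n N))
      pascal : ∀ i → i ≤ suc N → shift κ i + κ i ≈ ιℕ (suc N C i)
      pascal zero    _ = +-identityˡ (κ 0)
      pascal (suc i) _ = trans (sym (ιℕ-homo-+ (N C i) (N C suc i))) (ιℕ-≡ (nCk+nC[k+1]≡[n+1]C[k+1] N i))

  q^b*binomial : ∀ b N p q → q ^ b * (p + q) ^ N ≈ homPoly (b ℕ.+ N) (ιℕ ∘ (N C_)) p q
  q^b*binomial zero    N p q = trans (*-identityˡ _) (binomial N p q)
  q^b*binomial (suc b) N p q = begin
    (q * q ^ b) * (p + q) ^ N                      ≈⟨ *-assoc q (q ^ b) _ ⟩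
    q * (q ^ b * (p + q) ^ N)                      ≈⟨ *-congˡ (q^b*binomial b N p q) ⟩
    q * homPoly (b ℕ.+ N) (ιℕ ∘ (N C_)) p q        ≈⟨ q*homPoly (b ℕ.+ N) (ιℕ ∘ (N C_)) p q
                                                        (ιℕ-≡ (k>n⇒nCk≡0 (s≤s (ℕ.m≤n+m N b)))) ⟩
    homPoly (suc b ℕ.+ N) (ιℕ ∘ (N C_)) p q        ∎

  p^a*homPoly : ∀ a N d p q → p ^ a * homPoly d (ιℕ ∘ (N C_)) p q ≈ homPoly (a ℕ.+ d) (ιℕ ∘ shiftedBinom a N) p q
  p^a*homPoly zero    N d p q = *-identityˡ _
  p^a*homPoly (suc a) N d p q = begin
    (p * p ^ a) * homPoly d (ιℕ ∘ (N C_)) p q        ≈⟨ *-assoc p (p ^ a) _ ⟩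
    p * (p ^ a * homPoly d (ιℕ ∘ (N C_)) p q)        ≈⟨ *-congˡ (p^a*homPoly a N d p q) ⟩
    p * homPoly (a ℕ.+ d) (ιℕ ∘ shiftedBinom a N) p q ≈⟨ p*homPoly (a ℕ.+ d) (ιℕ ∘ shiftedBinom a N) p q ⟩
    homPoly (suc a ℕ.+ d) (ιℕ ∘ shiftedBinom (suc a) N) p q ∎

  monomial*binomial : ∀ a b N {d} → a ℕ.+ (b ℕ.+ N) ≡ d → ∀ p q →
                      p ^ a * q ^ b * (p + q) ^ N ≈ homPoly d (ιℕ ∘ shiftedBinom a N) p q
  monomial*binomial a b N ≡.refl p q = begin
    p ^ a * q ^ b * (p + q) ^ N                              ≈⟨ *-assoc (p ^ a) (q ^ b) _ ⟩
    p ^ a * (q ^ b * (p + q) ^ N)                            ≈⟨ *-congˡ (q^b*binomial b N p q) ⟩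
    p ^ a * homPoly (b ℕ.+ N) (ιℕ ∘ (N C_)) p q              ≈⟨ p^a*homPoly a N (b ℕ.+ N) p q ⟩
    homPoly (a ℕ.+ (b ℕ.+ N)) (ιℕ ∘ shiftedBinom a N) p q    ∎

  *-Σ-homPoly : ∀ J d x {t γ : ℕ → Carrier} (c : ℕ → ℕ → Carrier) p q →
                (∀ j → 1 ≤ j → j ≤ J → x * t j ≈ γ j * homPoly d (c j) p q) →
                x * Σ[1… J ] t ≈ homPoly d (λ m → Σ[1… J ] (λ j → γ j * c j m)) p q
  *-Σ-homPoly zero    d x c p q _  = trans (zeroʳ x) (sym (homPoly-0 d p q))
  *-Σ-homPoly (suc J) d x {t} {γ} c p q xt≈ = begin
    x * (Σ[1… J ] t + t (suc J))  ≈⟨ distribˡ x _ _ ⟩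
    x * Σ[1… J ] t + x * t (suc J)
                                  ≈⟨ +-cong (*-Σ-homPoly J d x c p q (λ j 1≤j j≤J → xt≈ j 1≤j (ℕ.m≤n⇒m≤1+n j≤J)))
                                            (xt≈ (suc J) (s≤s z≤n) ℕ.≤-refl) ⟩
    homPoly d (λ m → Σ[1… J ] (λ j → γ j * c j m)) p q + γ (suc J) * homPoly d (c (suc J)) p q
                                  ≈⟨ +-congˡ (homPoly-* d (γ (suc J)) (c (suc J)) p q) ⟨
    homPoly d (λ m → Σ[1… J ] (λ j → γ j * c j m)) p q + homPoly d (λ m → γ (suc J) * c (suc J) m) p q
                                  ≈⟨ homPoly-+ d _ _ p q ⟨
    homPoly d (λ m → Σ[1… suc J ] (λ j → γ j * c j m)) p q ∎

  homPoly[x,1] : ∀ d c x → homPoly d c x 1# ≈ eval (tabulate {n = suc d} (c ∘ toℕ)) x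
  homPoly[x,1] zero    c x = sym (trans (+-congˡ (zeroʳ x)) (+-identityʳ (c 0)))
  homPoly[x,1] (suc d) c x = +-cong (trans (*-congˡ (1^n≈1 (suc d))) (*-identityʳ (c 0))) (*-congˡ (homPoly[x,1] d (c ∘ suc) x))

  -- Dehomogenise at q = 1; the difference of the two polynomials then has infinitely many roots.
  homPoly-coefficients : ∀ (xs : ℕ → Carrier) → Injective _≡_ _≈_ xs → ∀ d c c′ →
                         (∀ t → homPoly d c (xs t) 1# ≈ homPoly d c′ (xs t) 1#) → ∀ m → m ≤ d → c m ≈ c′ m
  homPoly-coefficients xs inj d c c′ agree m m≤d =
    x-y≈0⇒x≈y _ _ (≡.subst (λ i → difference i ≈ 0#) (toℕ-fromℕ< m<1+d) (tabulate⁻ {f = difference ∘ toℕ} all≈0 (fromℕ< m<1+d)))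
    where
      difference : ℕ → Carrier
      difference i = c i - c′ i
      difference-vanishes : ∀ t → eval (tabulate {n = suc d} (difference ∘ toℕ)) (xs t) ≈ 0#
      difference-vanishes t = begin
        eval (tabulate {n = suc d} (difference ∘ toℕ)) (xs t) ≈⟨ homPoly[x,1] d difference (xs t) ⟨
        homPoly d difference (xs t) 1#                  ≈⟨ homPoly-− d c c′ (xs t) 1# ⟩
        homPoly d c (xs t) 1# - homPoly d c′ (xs t) 1#  ≈⟨ x≈y⇒x∙y⁻¹≈ε (agree t) ⟩
        0#                                              ∎
      all≈0 = vanishing⇒All≈0 xs inj (tabulate (difference ∘ toℕ)) difference-vanishes
      m<1+d = s≤s m≤d


module ClearedDenominators {c ℓ} (K : Field c ℓ) (n : ℕ) (1≤n : 1 ≤ n) (α β : ℕ → Field.Carrier K) where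
  open Field K
  open FieldOps K
  open FieldLemmas K
  open HomogeneousPolynomials K
  open Exponents n 1≤n
  open Fn K using (g; h; coeffCond; CoeffConds)
  open import Relation.Binary.Reasoning.Setoid setoid
  open import Algebra.Properties.CommutativeSemigroup *-commutativeSemigroup using (xy∙z≈zy∙x; xy∙z≈xz∙y)
  open import Algebra.Properties.CommutativeSemigroup +-commutativeSemigroup using () renaming (xy∙z≈xz∙y to x+y+z≈x+z+y)

  -- The coefficients of p^m q^(degree - m) in p^N q^N (p+q)^N g_n(p,q) and in p^N q^N (p+q)^N h_n(p,q).
  gCoeff hCoeff : ℕ → Carrier
  gCoeff m = Σ[1… 2 ℕ.* n ℕ.+ 1 ] (λ j → α j * ((ιℕ (shiftedBinom (a j) N m) - ιℕ (shiftedBinom N (a j) m))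
                                                   - ιℕ (shiftedBinom (a j) (b j) m)))
  hCoeff m = Σ[1… n ] (λ k → β k * ιℕ (shiftedBinom (a (2 ℕ.* k)) N m))

  binom-terms≈shiftedBinom-terms : ∀ {m j} → 1 ≤ j → j ≤ 2 ℕ.* n ℕ.+ 1 →
    ιℤ ((binom N ((ℤ.+ m ℤ.- ℤ.+ (4 ℕ.* n)) ℤ.+ ℤ.+ j) ℤ.- binom (b j) ((ℤ.+ m ℤ.- ℤ.+ (4 ℕ.* n)) ℤ.+ ℤ.+ j))
          ℤ.- binom (a j) (ℤ.+ m ℤ.- ℤ.+ N))
      ≈ (ιℕ (shiftedBinom (a j) N m) - ιℕ (shiftedBinom N (a j) m)) - ιℕ (shiftedBinom (a j) (b j) m)
  binom-terms≈shiftedBinom-terms {m} {j} 1≤j j≤2n+1 = begin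
    ιℤ ((binom N X ℤ.- binom (b j) X) ℤ.- binom (a j) (ℤ.+ m ℤ.- ℤ.+ N))
      ≡⟨ ≡.cong₂ (λ u v → ιℤ (u ℤ.- v)) (≡.cong₂ ℤ._-_ (binom-shift N m j≤4n′) (binom-shift (b j) m j≤4n′))
                 (≡.trans (≡.cong (binom (a j)) (ℤ.m-n≡m⊖n m N)) (binom-⊖ (a j) N m)) ⟩
    ιℤ ((ℤ.+ S₁ ℤ.- ℤ.+ S₃) ℤ.- ℤ.+ S₂)   ≈⟨ ιℤ-homo-− (ℤ.+ S₁ ℤ.- ℤ.+ S₃) (ℤ.+ S₂) ⟩
    ιℤ (ℤ.+ S₁ ℤ.- ℤ.+ S₃) - ιℕ S₂         ≈⟨ +-congʳ (ιℤ-homo-− (ℤ.+ S₁) (ℤ.+ S₃)) ⟩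
    (ιℕ S₁ - ιℕ S₃) - ιℕ S₂                ≈⟨ x+y+z≈x+z+y (ιℕ S₁) (- ιℕ S₃) (- ιℕ S₂) ⟩
    (ιℕ S₁ - ιℕ S₂) - ιℕ S₃                ∎
    where
      X = (ℤ.+ m ℤ.- ℤ.+ (4 ℕ.* n)) ℤ.+ ℤ.+ j
      j≤4n′ = j≤4n 1≤j j≤2n+1
      S₁ = shiftedBinom (a j) N m
      S₂ = shiftedBinom N (a j) m
      S₃ = shiftedBinom (a j) (b j) m

  coeffCond⇔ : ∀ m → coeffCond n α β m ⇔ (gCoeff m ≈ hCoeff m)
  coeffCond⇔ m = mk⇔ (λ e → trans (sym gSum) (trans e hSum)) (λ e → trans gSum (trans e (sym hSum)))
    where
      gSum = Σ-cong (2 ℕ.* n ℕ.+ 1) (λ j 1≤j j≤2n+1 → *-congˡ (binom-terms≈shiftedBinom-terms {m} 1≤j j≤2n+1))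
      hSum = Σ-cong n (λ k 1≤k k≤n →
        *-congˡ (≡⇒≈ (≡.cong ιℤ (binom-shift N m (j≤4n (1≤2k 1≤k k≤n) (2k≤2n+1 1≤k k≤n))))))

  gCoeff≈hCoeff-below : ∀ {m} → m < 2 ℕ.* n → gCoeff m ≈ hCoeff m
  gCoeff≈hCoeff-below {m} m<2n = trans
    (Σ-≈0 _ (λ j 1≤j j≤2n+1 → x≈0⇒y*x≈0 (α j) (x≈z∧y≈0⇒x-y-z≈0
      (ιℕ-≡ (shiftedBinom-≤ (a j) N (b j) (≤a 1≤j j≤2n+1 m<2n)))
      (ιℕ-≡ (shiftedBinom-< N (a j) (<6n m<2n))))))
    (sym (Σ-≈0 n (λ k 1≤k k≤n → x≈0⇒y*x≈0 (β k)
      (ιℕ-≡ (shiftedBinom-< (a (2 ℕ.* k)) N (<a2k 1≤k k≤n m<2n))))))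

  gCoeff≈hCoeff-above : ∀ {m} → 10 ℕ.* n ℕ.∸ 2 < m → gCoeff m ≈ hCoeff m
  gCoeff≈hCoeff-above {m} 10n∸2<m = trans
    (Σ-≈0 _ (λ j 1≤j j≤2n+1 → x≈0⇒y*x≈0 (α j) (x≈y∧z≈0⇒x-y-z≈0
      (ιℕ-≡ (shiftedBinom-comm (a j) N (a+N≤ 1≤j j≤2n+1 10n≤1+m)))
      (ιℕ-≡ (shiftedBinom-> (a j) (b j) (a+b< 1≤j j≤2n+1 10n≤1+m))))))
    (sym (Σ-≈0 n (λ k 1≤k k≤n → x≈0⇒y*x≈0 (β k)
      (ιℕ-≡ (shiftedBinom-> (a (2 ℕ.* k)) N (a2k+N< 1≤k k≤n 10n≤1+m))))))
    where 10n≤1+m = 10n≤suc 10n∸2<m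

  CoeffConds⇒gCoeff≈hCoeff : CoeffConds n α β → ∀ m → gCoeff m ≈ hCoeff m
  CoeffConds⇒gCoeff≈hCoeff conds m with m ℕ.<? 2 ℕ.* n | m ℕ.≤? 10 ℕ.* n ℕ.∸ 2
  ... | yes m<2n | _        = gCoeff≈hCoeff-below m<2n
  ... | no m≮2n  | yes m≤   = Equivalence.to (coeffCond⇔ m) (conds m (ℕ.≮⇒≥ m≮2n) m≤)
  ... | no _     | no m≰    = gCoeff≈hCoeff-above (ℕ.≰⇒> m≰)

  module AtPoint (p q : Carrier) (p≉0 : p ≉ 0#) (q≉0 : q ≉ 0#) (p+q≉0 : p + q ≉ 0#) where
    D : Carrier
    D = p ^ N * q ^ N * (p + q) ^ N

    D≉0 : D ≉ 0#
    D≉0 = *-≉0 (*-≉0 (^-≉0 N p≉0) (^-≉0 N q≉0)) (^-≉0 N p+q≉0)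

    module _ (γ : Carrier) {j} (1≤j : 1 ≤ j) (j≤2n+1 : j ≤ 2 ℕ.* n ℕ.+ 1) where
      private
        a+b+N = a+b+N≡degree 1≤j j≤2n+1
        cancel : ∀ {u v} w → u ≉ 0# → v ≉ 0# → (u ^ N * v ^ N * w) * (γ / (u ^ A j * v ^ B j)) ≈ γ * (u ^ a j * v ^ b j * w)
        cancel w u≉0 v≉0 = cancel-monomial {A = A j} {a j} {B j} {b j} w γ u≉0 v≉0
                             (p-exponents 1≤j j≤2n+1) (q-exponents 1≤j j≤2n+1)

      term₁ : D * (γ / (p ^ A j * q ^ B j)) ≈ γ * homPoly degree (ιℕ ∘ shiftedBinom (a j) N) p q
      term₁ = begin
        D * (γ / (p ^ A j * q ^ B j))                    ≈⟨ cancel ((p + q) ^ N) p≉0 q≉0 ⟩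
        γ * (p ^ a j * q ^ b j * (p + q) ^ N)            ≈⟨ *-congˡ (monomial*binomial (a j) (b j) N deg p q) ⟩
        γ * homPoly degree (ιℕ ∘ shiftedBinom (a j) N) p q ∎
        where deg = ≡.trans (≡.sym (ℕ.+-assoc (a j) (b j) N)) a+b+N

      term₂ : D * (γ / ((p + q) ^ A j * q ^ B j)) ≈ γ * homPoly degree (ιℕ ∘ shiftedBinom N (a j)) p q
      term₂ = begin
        D * (γ / ((p + q) ^ A j * q ^ B j))                         ≈⟨ *-congʳ (xy∙z≈zy∙x (p ^ N) (q ^ N) ((p + q) ^ N)) ⟩
        ((p + q) ^ N * q ^ N * p ^ N) * (γ / ((p + q) ^ A j * q ^ B j)) ≈⟨ cancel (p ^ N) p+q≉0 q≉0 ⟩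
        γ * ((p + q) ^ a j * q ^ b j * p ^ N)                       ≈⟨ *-congˡ (xy∙z≈zy∙x ((p + q) ^ a j) (q ^ b j) (p ^ N)) ⟩
        γ * (p ^ N * q ^ b j * (p + q) ^ a j)                       ≈⟨ *-congˡ (monomial*binomial N (b j) (a j) deg p q) ⟩
        γ * homPoly degree (ιℕ ∘ shiftedBinom N (a j)) p q           ∎
        where deg = ≡.trans (ℕ.+-comm N (b j ℕ.+ a j)) (≡.trans (≡.cong (ℕ._+ N) (ℕ.+-comm (b j) (a j))) a+b+N)

      term₃ : D * (γ / (p ^ A j * (p + q) ^ B j)) ≈ γ * homPoly degree (ιℕ ∘ shiftedBinom (a j) (b j)) p q
      term₃ = begin
        D * (γ / (p ^ A j * (p + q) ^ B j))                         ≈⟨ *-congʳ (xy∙z≈xz∙y (p ^ N) (q ^ N) ((p + q) ^ N)) ⟩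
        (p ^ N * (p + q) ^ N * q ^ N) * (γ / (p ^ A j * (p + q) ^ B j)) ≈⟨ cancel (q ^ N) p≉0 p+q≉0 ⟩
        γ * (p ^ a j * (p + q) ^ b j * q ^ N)                       ≈⟨ *-congˡ (xy∙z≈xz∙y (p ^ a j) ((p + q) ^ b j) (q ^ N)) ⟩
        γ * (p ^ a j * q ^ N * (p + q) ^ b j)                       ≈⟨ *-congˡ (monomial*binomial (a j) N (b j) deg p q) ⟩
        γ * homPoly degree (ιℕ ∘ shiftedBinom (a j) (b j)) p q       ∎
        where deg = ≡.trans (≡.cong (a j ℕ.+_) (ℕ.+-comm N (b j))) (≡.trans (≡.sym (ℕ.+-assoc (a j) (b j) N)) a+b+N)

    D*g : D * g n α p q ≈ homPoly degree gCoeff p q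
    D*g = begin
      D * ((Σ[1… J ] t₁ - Σ[1… J ] t₂) - Σ[1… J ] t₃)
        ≈⟨ *-congˡ (trans (Σ-homo-− J _ t₃) (+-congʳ (Σ-homo-− J t₁ t₂))) ⟨
      D * Σ[1… J ] (λ j → (t₁ j - t₂ j) - t₃ j)
        ≈⟨ *-Σ-homPoly J degree D κ p q summand ⟩
      homPoly degree gCoeff p q
        ∎
      where
        J = 2 ℕ.* n ℕ.+ 1
        t₁ t₂ t₃ : ℕ → Carrier
        t₁ j = α j / (p ^ A j * q ^ B j)
        t₂ j = α j / ((p + q) ^ A j * q ^ B j)
        t₃ j = α j / (p ^ A j * (p + q) ^ B j)
        κ : ℕ → ℕ → Carrier
        κ j m = (ιℕ (shiftedBinom (a j) N m) - ιℕ (shiftedBinom N (a j) m)) - ιℕ (shiftedBinom (a j) (b j) m)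
        summand : ∀ j → 1 ≤ j → j ≤ J → D * ((t₁ j - t₂ j) - t₃ j) ≈ α j * homPoly degree (κ j) p q
        summand j 1≤j j≤J = begin
          D * ((t₁ j - t₂ j) - t₃ j)
            ≈⟨ solve 4 (λ D x y z → D :* ((x :- y) :- z) := (D :* x :- D :* y) :- D :* z) refl D (t₁ j) (t₂ j) (t₃ j) ⟩
          (D * t₁ j - D * t₂ j) - D * t₃ j
            ≈⟨ +-cong (+-cong (term₁ (α j) 1≤j j≤J) (-‿cong (term₂ (α j) 1≤j j≤J))) (-‿cong (term₃ (α j) 1≤j j≤J)) ⟩
          (α j * H₁ - α j * H₂) - α j * H₃
            ≈⟨ solve 4 (λ γ x y z → (γ :* x :- γ :* y) :- γ :* z := γ :* ((x :- y) :- z)) refl (α j) H₁ H₂ H₃ ⟩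
          α j * ((H₁ - H₂) - H₃)
            ≈⟨ *-congˡ (trans (homPoly-− degree _ _ p q) (+-congʳ (homPoly-− degree _ _ p q))) ⟨
          α j * homPoly degree (κ j) p q
            ∎
          where
            H₁ = homPoly degree (ιℕ ∘ shiftedBinom (a j) N) p q
            H₂ = homPoly degree (ιℕ ∘ shiftedBinom N (a j)) p q
            H₃ = homPoly degree (ιℕ ∘ shiftedBinom (a j) (b j)) p q

    D*h : D * h n β p q ≈ homPoly degree hCoeff p q
    D*h = *-Σ-homPoly n degree D (λ k → ιℕ ∘ shiftedBinom (a (2 ℕ.* k)) N) p q
            (λ k 1≤k k≤n → term₁ (β k) (1≤2k 1≤k k≤n) (2k≤2n+1 1≤k k≤n))

    cleared : g n α p q ≈ h n β p q ⇔ homPoly degree gCoeff p q ≈ homPoly degree hCoeff p q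
    cleared = mk⇔ (λ g≈h → trans (sym D*g) (trans (*-congˡ g≈h) D*h))
                  (λ G≈H → *-cancelˡ D≉0 (trans D*g (trans G≈H (sym D*h))))

lemma2p1 : ∀ {c ℓ : Level} (K : Field c ℓ) → CharZero K →
    (n : ℕ) → 1 ≤ n → (α β : ℕ → Field.Carrier K) →
    Fn.RatIdentity K n α β ⇔ Fn.CoeffConds K n α β
lemma2p1 K charZero n 1≤n α β = mk⇔ to from
  where
    open Field K
    open FieldOps K
    open FieldLemmas K using (ιℕ-injective; 1≉0)
    open HomogeneousPolynomials K using (homPoly; homPoly-cong; homPoly-coefficients)
    open Exponents n 1≤n using (degree; ≤degree)
    open ClearedDenominators K n 1≤n α β

    xs : ℕ → Carrier
    xs t = ιℕ (suc t)

    xs+1≉0 : ∀ t → xs t + 1# ≉ 0#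
    xs+1≉0 t e = charZero (suc t) (trans (+-comm 1# (xs t)) e)

    to : Fn.RatIdentity K n α β → Fn.CoeffConds K n α β
    to g≈h m _ m≤10n∸2 = Equivalence.from (coeffCond⇔ m)
      (homPoly-coefficients xs (ℕ.suc-injective ∘ ιℕ-injective charZero) degree gCoeff hCoeff agree m (≤degree m≤10n∸2))
      where
        agree : ∀ t → homPoly degree gCoeff (xs t) 1# ≈ homPoly degree hCoeff (xs t) 1#
        agree t = Equivalence.to (AtPoint.cleared (xs t) 1# (charZero t) 1≉0 (xs+1≉0 t))
                    (g≈h (xs t) 1# (charZero t) 1≉0 (xs+1≉0 t))

    from : Fn.CoeffConds K n α β → Fn.RatIdentity K n α β
    from conds p q p≉0 q≉0 p+q≉0 = Equivalence.from (AtPoint.cleared p q p≉0 q≉0 p+q≉0)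
      (homPoly-cong degree p q (λ m _ → CoeffConds⇒gCoeff≈hCoeff conds m))
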